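{- Let $T$ be a tree of order $n \geq 3$ with $l$ leaves. Then $\gamma(T) = n - l$ if and only if every vertex of $T$ is either a leaf or a support vertex.
   Context: A leaf is a vertex of degree one; its unique neighbor is called a support vertex. A set $D \subseteq V(T)$ is a dominating set if every vertex not in $D$ is adjacent to a vertex of $D$; $\gamma(T)$ is the minimum cardinality of a dominating set of $T$. -}

module Defs where

open import Data.Nat using (ℕ; zero; suc; _+_; _∸_; _≤_; _≥_)
open import Data.Fin using (Fin)
open import Data.Fin.Subset using (Subset; _∈_; _∉_; ∣_∣)
open import Data.Bool using (Bool; true; false)
open import Data.List using (List; []; _∷_; length; filter; head; last)
open import Data.List.Base using (allFin)
open import Data.List.Relation.Unary.Unique.Propositional using (Unique)
open import Data.List.Relation.Unary.Linked using (Linked)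
open import Data.Maybe using (just)
open import Data.Product using (Σ; _×_; ∃; ∃-syntax; _,_)
open import Relation.Binary.PropositionalEquality using (_≡_)
open import Relation.Nullary using (¬_)
open import Relation.Nullary.Decidable using (does)
open import Data.Bool using (_≟_)

record Graph (n : ℕ) : Set where
  field
    adj     : Fin n → Fin n → Bool
    sym     : ∀ u v → adj u v ≡ adj v u
    irrefl  : ∀ v → adj v v ≡ false

open Graph public

Adj : ∀ {n} → Graph n → Fin n → Fin n → Set
Adj G u v = adj G u v ≡ true

neighbours : ∀ {n} → Graph n → Fin n → List (Fin n)
neighbours {n} G v = filter (λ u → adj G v u ≟ true) (allFin n)

degree : ∀ {n} → Graph n → Fin n → ℕ
degree G v = length (neighbours G v)

IsWalk : ∀ {n} → Graph n → List (Fin n) → Set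
IsWalk G vs = Linked (Adj G) vs

Connected : ∀ {n} → Graph n → Set
Connected {n} G = ∀ (u v : Fin n) →
  ∃[ p ] (IsWalk G p × head p ≡ just u × last p ≡ just v)

HasCycle : ∀ {n} → Graph n → Set
HasCycle {n} G = ∃[ p ] (3 ≤ length p × Unique p × IsWalk G p ×
  ∃[ a ] ∃[ b ] (head p ≡ just a × last p ≡ just b × Adj G b a))

Acyclic : ∀ {n} → Graph n → Set
Acyclic G = ¬ HasCycle G

IsTree : ∀ {n} → Graph n → Set
IsTree G = Connected G × Acyclic G

IsLeaf : ∀ {n} → Graph n → Fin n → Set
IsLeaf G v = degree G v ≡ 1

IsSupport : ∀ {n} → Graph n → Fin n → Set
IsSupport G v = ∃[ u ] (IsLeaf G u × Adj G u v)

numLeaves : ∀ {n} → Graph n → ℕ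
numLeaves {n} G = length (filter (λ v → Data.Nat._≟_ (degree G v) 1) (allFin n))

Dominating : ∀ {n} → Graph n → Subset n → Set
Dominating {n} G D = ∀ (v : Fin n) → v ∉ D → ∃[ u ] (u ∈ D × Adj G v u)

IsDominationNumber : ∀ {n} → Graph n → ℕ → Set
IsDominationNumber G k =
  (∃[ D ] (Dominating G D × ∣ D ∣ ≡ k)) × (∀ D → Dominating G D → k ≤ ∣ D ∣)

-- Whenever a connected graph G on n ≥ 3 vertices has a non-leaf, non-support
-- vertex v, the non-leaves other than v still dominate G, so γ(G) < n − l.
-- Conversely, if every vertex is a leaf or a support vertex, then any dominating
-- set D receives an injection from the non-leaves: a non-leaf s in D goes to
-- itself, and otherwise to a leaf hanging at s, which must lie in D because its
-- only neighbour s does not.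
module Submission where

open import Defs hiding (sym)
open import Data.Nat using (ℕ; zero; suc; _≥_; _≤_; _∸_; z≤n; s≤s)
open import Data.Nat.Properties using (≤-trans; <⇒≱) renaming (_≟_ to _≟ⁿ_)
open import Data.Fin using (Fin; zero; suc)
open import Data.Fin.Properties using (suc-injective; 0≢1+n; any?) renaming (_≟_ to _≟ᶠ_)
open import Data.Fin.Subset using (Subset; _∈_; _∉_; ∣_∣; ∁; _-_; inside; outside)
open import Data.Fin.Subset.Properties
  using (_∈?_; drop-there; x∈p∧x≢y⇒x∈p-y; x∈p⇒∣p-x∣<∣p∣; x∉p⇒x∈∁p; x∈∁p⇒x∉p; x∉∁p⇒x∈p; ∣∁p∣≡n∸∣p∣)
open import Data.Vec using ([]; _∷_; here; there; tabulate)
open import Data.List as List using (List; filter; length; last)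
open import Data.List.Membership.Propositional using () renaming (_∈_ to _∈ˡ_)
open import Data.List.Membership.Propositional.Properties using (∈-filter⁺; ∈-allFin)
open import Data.List.Relation.Unary.Any using (here; there)
open import Data.List.Relation.Unary.Linked using (Linked; _∷_)
open import Data.Maybe using (just)
open import Data.Maybe.Properties using (just-injective)
open import Data.Product using (_×_; ∃-syntax; _,_)
open import Data.Sum using (_⊎_; inj₁; inj₂)
open import Data.Bool using (true; false)
open import Data.Bool.Properties using () renaming (_≟_ to _≟ᵇ_)
open import Function using (_∘_)
open import Function.Bundles using (_⇔_; mk⇔)
open import Relation.Binary.PropositionalEquality using (_≡_; _≢_; refl; sym; trans; cong; subst)
open import Relation.Nullary using (¬_; yes; no; does; contradiction; _×-dec_)
open import Relation.Unary using (Pred; Decidable)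

select : ∀ {n p} {P : Pred (Fin n) p} → Decidable P → Subset n
select P? = tabulate (does ∘ P?)

∈-select⁺ : ∀ {n p} {P : Pred (Fin n) p} (P? : Decidable P) {x} → P x → x ∈ select P?
∈-select⁺ P? {zero} Px with P? zero
... | yes _  = here
... | no ¬Px = contradiction Px ¬Px
∈-select⁺ P? {suc x} Px = there (∈-select⁺ (P? ∘ suc) Px)

∈-select⁻ : ∀ {n p} {P : Pred (Fin n) p} (P? : Decidable P) {x} → x ∈ select P? → P x
∈-select⁻ P? {zero} x∈ with P? zero | x∈
... | yes Px | here = Px
∈-select⁻ P? {suc x} x∈ = ∈-select⁻ (P? ∘ suc) (drop-there x∈)

length-filter-tabulate : ∀ {a p} {A : Set a} {P : Pred A p} (P? : Decidable P) {n} (f : Fin n → A) →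
  length (filter P? (List.tabulate f)) ≡ ∣ tabulate (does ∘ P? ∘ f) ∣
length-filter-tabulate P? {zero} f = refl
length-filter-tabulate P? {suc n} f with does (P? (f zero))
... | true  = cong suc (length-filter-tabulate P? (f ∘ suc))
... | false = length-filter-tabulate P? (f ∘ suc)

injective-relation⇒∣p∣≤∣q∣ : ∀ {n m} (R : Fin n → Fin m → Set) (p : Subset n) (q : Subset m) →
  (∀ {x} → x ∈ p → ∃[ y ] (y ∈ q × R x y)) →
  (∀ {x x′ y} → x ∈ p → x′ ∈ p → R x y → R x′ y → x ≡ x′) →
  ∣ p ∣ ≤ ∣ q ∣
injective-relation⇒∣p∣≤∣q∣ R [] q total injective = z≤n
injective-relation⇒∣p∣≤∣q∣ R (outside ∷ p) q total injective =
  injective-relation⇒∣p∣≤∣q∣ (R ∘ suc) p q (total ∘ there)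
    (λ x∈p x′∈p r r′ → suc-injective (injective (there x∈p) (there x′∈p) r r′))
injective-relation⇒∣p∣≤∣q∣ R (inside ∷ p) q total injective with total here
... | y , y∈q , R0y = ≤-trans (s≤s (injective-relation⇒∣p∣≤∣q∣ (R ∘ suc) p (q - y) total′ injective′))
                              (x∈p⇒∣p-x∣<∣p∣ y∈q)
  where
  total′ : ∀ {x} → x ∈ p → ∃[ y′ ] (y′ ∈ q - y × R (suc x) y′)
  total′ x∈p with total (there x∈p)
  ... | y′ , y′∈q , r = y′ , x∈p∧x≢y⇒x∈p-y y′∈q (λ { refl → 0≢1+n (injective here (there x∈p) R0y r) }) , r
  injective′ : ∀ {x x′ y′} → x ∈ p → x′ ∈ p → R (suc x) y′ → R (suc x′) y′ → x ≡ x′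
  injective′ x∈p x′∈p r r′ = suc-injective (injective (there x∈p) (there x′∈p) r r′)

length≡1⇒∈-unique : ∀ {A : Set} {xs : List A} {a b : A} → length xs ≡ 1 → a ∈ˡ xs → b ∈ˡ xs → a ≡ b
length≡1⇒∈-unique {xs = _ List.∷ List.[]} _ (here refl) (here refl) = refl

Linked-last-closed : ∀ {A : Set} {R : A → A → Set} (P : A → Set) → (∀ {a b} → P a → R a b → P b) →
  ∀ {x xs z} → Linked R (x List.∷ xs) → P x → last (x List.∷ xs) ≡ just z → P z
Linked-last-closed P closed {xs = List.[]} _ Px refl = Px
Linked-last-closed P closed {xs = _ List.∷ _} (r ∷ walk) Px eq = Linked-last-closed P closed walk (closed Px r) eq

∃-distinct-from-two : ∀ {n} → n ≥ 3 → (u w : Fin n) → ∃[ z ] (z ≢ u × z ≢ w)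
∃-distinct-from-two (s≤s (s≤s (s≤s _))) u w = pick zero (suc zero) (suc (suc zero)) (λ ()) (λ ()) (λ ())
  where
  pick : ∀ a b c → b ≢ a → c ≢ a → c ≢ b → ∃[ z ] (z ≢ u × z ≢ w)
  pick a b c b≢a c≢a c≢b with a ≟ᶠ u | a ≟ᶠ w
  ... | no a≢u | no a≢w = a , a≢u , a≢w
  ... | yes refl | _ with b ≟ᶠ w
  ...   | no b≢w   = b , b≢a , b≢w
  ...   | yes refl = c , c≢a , c≢b
  pick a b c b≢a c≢a c≢b | no a≢u | yes refl with b ≟ᶠ u
  ...   | no b≢u   = b , b≢u , b≢a
  ...   | yes refl = c , c≢b , c≢a

module _ {n : ℕ} (G : Graph n) where

  Adj-sym : ∀ {u v} → Adj G u v → Adj G v u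
  Adj-sym {u} {v} uv = trans (Graph.sym G v u) uv

  Adj⇒≢ : ∀ {u v} → Adj G u v → u ≢ v
  Adj⇒≢ {u} uu refl = contradiction (trans (sym uu) (Graph.irrefl G u)) λ ()

  leaf-neighbour-unique : ∀ {u a b} → IsLeaf G u → Adj G u a → Adj G u b → a ≡ b
  leaf-neighbour-unique {u} leaf ua ub = length≡1⇒∈-unique leaf (∈-neighbours ua) (∈-neighbours ub)
    where
    ∈-neighbours : ∀ {a} → Adj G u a → a ∈ˡ neighbours G u
    ∈-neighbours {a} ua = ∈-filter⁺ (λ x → adj G u x ≟ᵇ true) (∈-allFin a) ua

  leaf? : Decidable (IsLeaf G)
  leaf? v = degree G v ≟ⁿ 1

  support? : Decidable (IsSupport G)
  support? v = any? (λ u → leaf? u ×-dec (adj G u v ≟ᵇ true))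

  nonLeaves : Subset n
  nonLeaves = ∁ (select leaf?)

  ∈-nonLeaves : ∀ {v} → ¬ IsLeaf G v → v ∈ nonLeaves
  ∈-nonLeaves ¬leaf = x∉p⇒x∈∁p (¬leaf ∘ ∈-select⁻ leaf?)

  ∈-nonLeaves⁻ : ∀ {v} → v ∈ nonLeaves → ¬ IsLeaf G v
  ∈-nonLeaves⁻ v∈ = x∈∁p⇒x∉p v∈ ∘ ∈-select⁺ leaf?

  ∉-nonLeaves⁻ : ∀ {v} → v ∉ nonLeaves → IsLeaf G v
  ∉-nonLeaves⁻ v∉ = ∈-select⁻ leaf? (x∉∁p⇒x∈p v∉)

  ∣nonLeaves∣ : ∣ nonLeaves ∣ ≡ n ∸ numLeaves G
  ∣nonLeaves∣ = trans (∣∁p∣≡n∸∣p∣ (select leaf?)) (cong (n ∸_) (sym (length-filter-tabulate leaf? (λ v → v))))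

  nonLeaves-minimum : (∀ v → IsLeaf G v ⊎ IsSupport G v) → ∀ D → Dominating G D → ∣ nonLeaves ∣ ≤ ∣ D ∣
  nonLeaves-minimum leaf-or-support D dominating = injective-relation⇒∣p∣≤∣q∣ R nonLeaves D total injective
    where
    R : Fin n → Fin n → Set
    R s y = y ≡ s ⊎ (IsLeaf G y × Adj G y s)
    total : ∀ {s} → s ∈ nonLeaves → ∃[ y ] (y ∈ D × R s y)
    total {s} s∈ with s ∈? D | leaf-or-support s
    ... | yes s∈D | _ = s , s∈D , inj₁ refl
    ... | no _ | inj₁ leaf = contradiction leaf (∈-nonLeaves⁻ s∈)
    ... | no s∉D | inj₂ (u , leaf , us) with u ∈? D
    ...   | yes u∈D = u , u∈D , inj₂ (leaf , us)
    ...   | no u∉D with dominating u u∉D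
    ...     | w , w∈D , uw = contradiction (subst (_∈ D) (leaf-neighbour-unique leaf uw us) w∈D) s∉D
    injective : ∀ {x x′ y} → x ∈ nonLeaves → x′ ∈ nonLeaves → R x y → R x′ y → x ≡ x′
    injective _ _ (inj₁ refl) (inj₁ refl) = refl
    injective x∈ _ (inj₁ refl) (inj₂ (leaf , _)) = contradiction leaf (∈-nonLeaves⁻ x∈)
    injective _ x′∈ (inj₂ (leaf , _)) (inj₁ refl) = contradiction leaf (∈-nonLeaves⁻ x′∈)
    injective _ _ (inj₂ (leaf , yx)) (inj₂ (_ , yx′)) = leaf-neighbour-unique leaf yx yx′

  module _ (connected : Connected G) (n≥3 : n ≥ 3) where

    ∃-neighbour : ∀ v → ∃[ u ] (Adj G v u)
    ∃-neighbour v with ∃-distinct-from-two n≥3 v v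
    ... | z , z≢v , _ with connected v z
    ... | _ List.∷ List.[] , _ , refl , last≡z = contradiction (just-injective (sym last≡z)) z≢v
    ... | _ List.∷ u List.∷ _ , vu ∷ _ , refl , _ = u , vu

    -- Two adjacent leaves would form a whole component, leaving no walk to a third vertex.
    leaves-nonadjacent : ∀ {u w} → IsLeaf G u → IsLeaf G w → ¬ Adj G u w
    leaves-nonadjacent {u} {w} leafu leafw uw with ∃-distinct-from-two n≥3 u w
    ... | z , z≢u , z≢w with connected u z
    ... | _ List.∷ _ , walk , refl , last≡z with Linked-last-closed (λ a → a ≡ u ⊎ a ≡ w) closed walk (inj₁ refl) last≡z
      where
      closed : ∀ {a b} → a ≡ u ⊎ a ≡ w → Adj G a b → b ≡ u ⊎ b ≡ w
      closed (inj₁ refl) ub = inj₂ (leaf-neighbour-unique leafu ub uw)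
      closed (inj₂ refl) wb = inj₁ (leaf-neighbour-unique leafw wb (Adj-sym uw))
    ... | inj₁ z≡u = z≢u z≡u
    ... | inj₂ z≡w = z≢w z≡w

    nonLeaves-dominating : Dominating G nonLeaves
    nonLeaves-dominating v v∉ with ∃-neighbour v
    ... | u , vu = u , ∈-nonLeaves (λ leafu → leaves-nonadjacent (∉-nonLeaves⁻ v∉) leafu vu) , vu

    nonLeaves-minus-dominating : ∀ {v} → ¬ IsLeaf G v → ¬ IsSupport G v → Dominating G (nonLeaves - v)
    nonLeaves-minus-dominating {v} ¬leaf ¬support w w∉nonLeaves-v with w ≟ᶠ v | ∃-neighbour w
    ... | yes refl | u , wu =
      u , x∈p∧x≢y⇒x∈p-y (∈-nonLeaves (λ leafu → ¬support (u , leafu , Adj-sym wu)))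
                        (Adj⇒≢ wu ∘ sym) , wu
    ... | no w≢v | u , wu with w ∈? nonLeaves
    ...   | yes w∈ = contradiction (x∈p∧x≢y⇒x∈p-y w∈ w≢v) w∉nonLeaves-v
    ...   | no w∉nonLeaves =
      u , x∈p∧x≢y⇒x∈p-y (∈-nonLeaves (λ leafu → leaves-nonadjacent (∉-nonLeaves⁻ w∉nonLeaves) leafu wu))
                        (λ { refl → ¬support (w , ∉-nonLeaves⁻ w∉nonLeaves , wu) }) , wu

theorem3p1 : (n : ℕ) → n ≥ 3 → (T : Graph n) → IsTree T →
    IsDominationNumber T (n ∸ numLeaves T) ⇔ (∀ (v : Fin n) → IsLeaf T v ⊎ IsSupport T v)
theorem3p1 n n≥3 T (connected , _) = mk⇔ forward backward
  where
  backward : (∀ v → IsLeaf T v ⊎ IsSupport T v) → IsDominationNumber T (n ∸ numLeaves T)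
  backward leaf-or-support =
    (nonLeaves T , nonLeaves-dominating T connected n≥3 , ∣nonLeaves∣ T) ,
    λ D dominating → subst (_≤ ∣ D ∣) (∣nonLeaves∣ T) (nonLeaves-minimum T leaf-or-support D dominating)

  forward : IsDominationNumber T (n ∸ numLeaves T) → ∀ v → IsLeaf T v ⊎ IsSupport T v
  forward (_ , minimum) v with leaf? T v | support? T v
  ... | yes leaf | _ = inj₁ leaf
  ... | no _ | yes support = inj₂ support
  ... | no ¬leaf | no ¬support = contradiction
    (subst (_≤ ∣ nonLeaves T - v ∣) (sym (∣nonLeaves∣ T))
      (minimum _ (nonLeaves-minus-dominating T connected n≥3 ¬leaf ¬support)))
    (<⇒≱ (x∈p⇒∣p-x∣<∣p∣ (∈-nonLeaves T ¬leaf)))
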